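{- Let $j,k$ be positive integers, $H$ a graph, $H''$ a connected induced subgraph of $H$ with at most $j$ vertices, and $H'=H-V(H'')$ with $\chi(H')\leq k$. Suppose $H''$ is $f$-choosable for the function $f(v)=k-d'(v)$, $v\in V(H'')$. Then $h_k(H)\leq h_k(H')+j$.
   Context: For $v\in V(H'')$, $d'(v)=|N_H(v)\cap V(H')|$. Given $f$, an $f$-list assignment $L$ gives each vertex $v$ a list of $f(v)$ positive integers; an $L$-coloring is a proper coloring $\phi$ with $\phi(v)\in L(v)$; a graph is $f$-choosable if every $f$-list assignment admits an $L$-coloring. For a graph $H$ and $k\geq\chi(H)$, a proper $k$-coloring is a map $V(H)\to[k]$ giving adjacent vertices different colors; $G^j_k(H)$ has the proper $k$-colorings of $H$ as vertices, two distinct colorings adjacent if $H$ contains a connected subgraph on at most $j$ vertices containing all vertices where they differ; $h_k(H)$ is the least $j\geq1$ with $G^j_k(H)$ Hamiltonian (complete graphs are regarded as Hamiltonian). -}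

module Defs where

open import Data.Nat using (ℕ; _≤_; _<_; _∸_; _+_)
open import Data.Bool using (Bool; true; false; _∧_; not)
open import Data.Fin using (Fin)
open import Data.Fin.Subset as Sub using (Subset; ∣_∣)
open import Data.Vec using (Vec; lookup; tabulate)
open import Data.List using (List; length; _∷_; _++_; [_])
import Data.List.Membership.Propositional as LM
open import Data.List.Relation.Unary.All using (All)
open import Data.List.Relation.Unary.Linked using (Linked)
open import Data.List.Relation.Unary.Unique.Propositional using (Unique)
open import Data.Product using (Σ; ∃; _×_; _,_)
open import Data.Sum using (_⊎_)
open import Relation.Binary.PropositionalEquality using (_≡_; _≢_)
open import Function.Bundles using (_⇔_)
open import Relation.Nullary using (¬_)

record Graph : Set where
  field
    n     : ℕ
    adj   : Fin n → Fin n → Bool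
    sym   : ∀ u v → adj u v ≡ adj v u
    irrefl : ∀ v → adj v v ≡ false
open Graph public

Edge : (G : Graph) → Fin (n G) → Fin (n G) → Set
Edge G u v = adj G u v ≡ true

data Reach (G : Graph) (W : Subset (n G)) : Fin (n G) → Fin (n G) → Set where
  here : ∀ {u} → Reach G W u u
  step : ∀ {u w v} → Edge G u w → w Sub.∈ W → Reach G W w v → Reach G W u v

ConnectedIn : (G : Graph) → Subset (n G) → Set
ConnectedIn G W = ∀ u v → u Sub.∈ W → v Sub.∈ W → Reach G W u v

-- Proper k-colourings, represented as vectors (so equality is decidable / extensional).
Coloring : ℕ → Graph → Set
Coloring k G = Vec (Fin k) (n G)

Proper : (k : ℕ) (G : Graph) → Coloring k G → Set
Proper k G c = ∀ u v → Edge G u v → lookup c u ≢ lookup c v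

ChromaticAtMost : ℕ → Graph → Set
ChromaticAtMost k G = Σ (Coloring k G) (Proper k G)

-- Adjacency in G^j_k(G): distinct, and some connected subgraph on at most j
-- vertices contains all vertices where the colourings differ.
ReconfAdj : (j k : ℕ) (G : Graph) → Coloring k G → Coloring k G → Set
ReconfAdj j k G c d =
  c ≢ d × Σ (Subset (n G)) λ W →
    ∣ W ∣ ≤ j × (∀ v → lookup c v ≢ lookup d v → v Sub.∈ W) × ConnectedIn G W

ReconfComplete : (j k : ℕ) (G : Graph) → Set
ReconfComplete j k G = ∀ c d → Proper k G c → Proper k G d → c ≢ d → ReconfAdj j k G c d

ReconfHamCycle : (j k : ℕ) (G : Graph) → Set
ReconfHamCycle j k G =
  Σ (Coloring k G) λ c → Σ (List (Coloring k G)) λ cs →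
    All (Proper k G) (c ∷ cs) × Unique (c ∷ cs) ×
    (∀ d → Proper k G d → d LM.∈ (c ∷ cs)) ×
    Linked (ReconfAdj j k G) ((c ∷ cs) ++ [ c ])

-- G^j_k(G) is Hamiltonian (complete graphs are regarded as Hamiltonian).
ReconfHamiltonian : (j k : ℕ) (G : Graph) → Set
ReconfHamiltonian j k G = ReconfComplete j k G ⊎ ReconfHamCycle j k G

-- "h_k(G) = h": h is the least j ≥ 1 with G^j_k(G) Hamiltonian.
IsHk : (k : ℕ) (G : Graph) (h : ℕ) → Set
IsHk k G h = 1 ≤ h × ReconfHamiltonian h k G ×
             (∀ j → 1 ≤ j → j < h → ¬ ReconfHamiltonian j k G)

-- d'(v) = |N_H(v) ∩ V(H')| where V(H') = V(H) ∖ S.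
dOut : (H : Graph) → Subset (n H) → Fin (n H) → ℕ
dOut H S v = ∣ tabulate (λ u → adj H v u ∧ not (lookup S u)) ∣

ListAssignment : (H : Graph) → Subset (n H) → (Fin (n H) → ℕ) → (Fin (n H) → List ℕ) → Set
ListAssignment H S f L =
  ∀ v → v Sub.∈ S → length (L v) ≡ f v × Unique (L v) × All (λ c → 0 < c) (L v)

ChoosableOn : (H : Graph) → Subset (n H) → (Fin (n H) → ℕ) → Set
ChoosableOn H S f =
  ∀ (L : Fin (n H) → List ℕ) → ListAssignment H S f L →
    Σ (Fin (n H) → ℕ) λ φ →
      (∀ v → v Sub.∈ S → φ v LM.∈ L v) ×
      (∀ u v → u Sub.∈ S → v Sub.∈ S → Edge H u v → φ u ≢ φ v)

-- H' is (an isomorphic copy of) H − S: an injective vertex map onto the complement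
-- of S, preserving and reflecting adjacency.
IsVertexDeletion : (H : Graph) → Subset (n H) → (H' : Graph) → (Fin (n H') → Fin (n H)) → Set
IsVertexDeletion H S H' ι =
  (∀ a b → ι a ≡ ι b → a ≡ b) ×
  (∀ a b → adj H' a b ≡ adj H (ι a) (ι b)) ×
  (∀ v → (v Sub.∉ S) ⇔ (∃ λ a → ι a ≡ v))

{-# OPTIONS --safe #-}
-- A proper k-colouring of H is a pair (c , σ): a proper colouring c of H′ = H − S together with an
-- extension σ of c to S, and every c has an extension because the lists of the colours of {1..k} not
-- used by c on the H′-neighbours of v have length at least k − d′(v). Two extensions of the same c
-- differ only inside the connected set S. If c and c′ are consecutive on a Hamiltonian cycle of
-- G^{h′}_k(H′), they differ inside a connected W with |W| ≤ h′. When some vertex of W is adjacent to S,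
-- every extension of c is adjacent in G^{h′+j}_k(H) to every extension of c′, as they differ inside the
-- connected set W ∪ S; otherwise c and c′ have the same extensions and (c , σ) is adjacent to (c′ , σ).
-- A Hamiltonian cycle of G^{h′+j}_k(H) is then obtained by sweeping through the fibres of extensions
-- along the cycle, closing up through a link of the first kind if there is one, and by a snake through
-- (cycle × fibre) if all links are of the second kind. Minimality of h_k(H) then gives h ≤ h′ + j.
module Submission where

open import Level using (0ℓ)
open import Function using (_∘_; case_of_)
open import Function.Bundles using (Equivalence)
open import Data.Empty using (⊥-elim)
open import Data.Bool using (true; _∧_; not)
import Data.Bool.Properties as Bool
open import Data.Nat using (ℕ; zero; suc; _≤_; _+_; _∸_; z≤n; s≤s; pred)
open import Data.Nat.Properties
  using (suc-injective; ≮⇒≥; ≤-trans; ≤-reflexive; +-suc; +-mono-≤; +-monoʳ-≤; m≤m+n; m≤n+m; ∸-monoʳ-≤; m≤n⇒m⊓n≡m)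
open import Data.Nat.DivMod using (_mod_; m<n⇒m%n≡m)
open import Data.Product using (∃; ∃₂; _×_; _,_; proj₁; proj₂; uncurry)
open import Data.Sum using (_⊎_; inj₁; inj₂)
open import Data.Fin using (Fin; zero; suc; toℕ)
import Data.Fin.Properties as Fin
open import Data.Fin.Subset using (Subset; ∣_∣; _∪_; ∁; ⁅_⁆; ⊥; inside; outside)
  renaming (_∈_ to _∈ₛ_; _∉_ to _∉ₛ_)
open import Data.Fin.Subset.Properties
  using (_∈?_; x∈p∪q⁺; x∈p∪q⁻; x∈⁅x⁆; x∈⁅y⁆⇒x≡y; ∉⊥; ∣⊥∣≡0; ∣⁅x⁆∣≡1; ∣p∣≤∣x∷p∣; x∈∁p⇒x∉p; ∣∁p∣≡n∸∣p∣)
open import Data.Vec using (Vec; []; _∷_; here; there; lookup; tabulate; replicate)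
open import Data.Vec.Properties using (lookup∘tabulate; lookup-replicate; lookup⇒[]=; ∷-injective)
open import Data.Vec.Relation.Binary.Pointwise.Extensional using (ext; Pointwise-≡⇒≡)
open import Data.List using (List; []; _∷_; _++_; [_]; map; filter; take; length; allFin; cartesianProductWith)
open import Data.List.Properties using (++-assoc; ++-identityʳ; map-++; filter-≐; length-map; length-take)
open import Data.List.Membership.Propositional using (_∈_)
open import Data.List.Membership.Propositional.Properties
  using (∈-∃++; ∈-++⁻; ∈-++⁺ˡ; ∈-++⁺ʳ; ∈-map⁺; ∈-map⁻; ∈-filter⁺; ∈-filter⁻; ∈-allFin; ∈-cartesianProductWith⁺)
open import Data.List.Relation.Unary.Any using (here; there)
open import Data.List.Relation.Unary.All as All using (All; []; _∷_)
import Data.List.Relation.Unary.All.Properties as All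
open import Data.List.Relation.Unary.AllPairs using ([]; _∷_)
open import Data.List.Relation.Unary.Linked as Linked using (Linked; []; [-]; _∷_)
import Data.List.Relation.Unary.Linked.Properties as Linked
open import Data.List.Relation.Unary.Unique.Propositional using (Unique)
import Data.List.Relation.Unary.Unique.Propositional.Properties as Unique
open import Data.List.Relation.Binary.Disjoint.Propositional using (Disjoint)
open import Data.List.Relation.Binary.Permutation.Propositional
  using (_↭_; prep; swap; ↭-refl; ↭-sym; ↭-trans; ↭-reflexive; ↭⇒↭ₛ)
open import Data.List.Relation.Binary.Permutation.Propositional.Properties
  using (shift; shifts; ++⁺; ++⁺ˡ; ++-comm; ∷↭∷ʳ; ∈-resp-↭; All-resp-↭)
  renaming (map⁺ to ↭-map⁺)
import Data.List.Relation.Binary.Permutation.Setoid.Properties as ↭ₛ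
import Data.List.Relation.Binary.Sublist.Propositional as Sublist
open import Data.List.Relation.Binary.Sublist.Propositional.Properties using (take-⊆)
open import Relation.Binary.Core using (Rel)
open import Relation.Binary.Definitions using (Symmetric)
open import Relation.Binary.PropositionalEquality
  using (_≡_; _≢_; refl; sym; trans; cong; cong₂; subst; subst₂; setoid; resp₂; ≢-sym; module ≡-Reasoning)
open import Relation.Nullary using (¬_; Dec; yes; no; contradiction; ¬?)
open import Relation.Nullary.Decidable using (_×-dec_; _→-dec_)

open import Defs hiding (sym)

module _ {A : Set} where

  lastOf : A → List A → A
  lastOf x []       = x
  lastOf _ (y ∷ ys) = lastOf y ys

  lastOf-∈ : ∀ x xs → lastOf x xs ∈ x ∷ xs
  lastOf-∈ x []       = here refl
  lastOf-∈ x (y ∷ ys) = there (lastOf-∈ y ys)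

  lastOf-++ : ∀ x xs y ys → lastOf x (xs ++ y ∷ ys) ≡ lastOf y ys
  lastOf-++ x []       y ys = refl
  lastOf-++ x (z ∷ zs) y ys = lastOf-++ z zs y ys

  Unique-resp-↭ : ∀ {xs ys : List A} → xs ↭ ys → Unique xs → Unique ys
  Unique-resp-↭ p = ↭ₛ.AllPairs-resp-↭ (setoid A) ≢-sym (resp₂ _≢_) (↭⇒↭ₛ p)

  ∈⇒↭∷ : ∀ {x : A} {xs} → x ∈ xs → ∃ λ ys → xs ↭ x ∷ ys
  ∈⇒↭∷ x∈ with ∈-∃++ x∈
  ... | ys , zs , refl = ys ++ zs , shift _ ys zs

  ∈²⇒↭∷∷ : ∀ {x y : A} {xs} → x ∈ xs → y ∈ xs → x ≢ y → ∃ λ zs → xs ↭ x ∷ y ∷ zs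
  ∈²⇒↭∷∷ {x} x∈ y∈ x≢y with ∈⇒↭∷ x∈
  ... | ys , xs↭x∷ys with ∈-resp-↭ xs↭x∷ys y∈
  ...   | here y≡x    = contradiction (sym y≡x) x≢y
  ...   | there y∈ys with ∈⇒↭∷ y∈ys
  ...     | zs , ys↭y∷zs = zs , ↭-trans xs↭x∷ys (prep x ys↭y∷zs)

  ++-∷ʳ-assoc : ∀ xs (y : A) ys z zs → (xs ++ y ∷ ys ++ [ z ]) ++ zs ≡ xs ++ y ∷ ys ++ z ∷ zs
  ++-∷ʳ-assoc xs y ys z zs = trans (++-assoc xs (y ∷ ys ++ [ z ]) zs) (cong (λ t → xs ++ y ∷ t) (++-assoc ys [ z ] zs))

  singleton⊎distinct : ∀ {x : A} {xs} → Unique xs → x ∈ xs →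
                        (∃ λ e → xs ≡ [ e ]) ⊎ (∃₂ λ y z → y ∈ xs × z ∈ xs × y ≢ z)
  singleton⊎distinct {xs = e ∷ []}    _                 _ = inj₁ (e , refl)
  singleton⊎distinct {xs = y ∷ z ∷ _} ((y≢z ∷ _) ∷ _) _ = inj₂ (y , z , here refl , there (here refl) , y≢z)

  UniqueNonEmpty : List A → Set
  UniqueNonEmpty xs = Unique xs × ∃ (_∈ xs)

  module _ {R : Rel A 0ℓ} where

    Linked-join : ∀ {x xs y ys} → Linked R (x ∷ xs) → R (lastOf x xs) y → Linked R (y ∷ ys) →
                  Linked R (x ∷ xs ++ y ∷ ys)
    Linked-join [-]       r l = r ∷ l
    Linked-join (r₀ ∷ l₀) r l = r₀ ∷ Linked-join l₀ r l

    Linked-∷ʳ⁻ : ∀ {x} xs {y} → Linked R (x ∷ xs ++ [ y ]) → Linked R (x ∷ xs) × R (lastOf x xs) y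
    Linked-∷ʳ⁻ []       (r ∷ [-]) = [-] , r
    Linked-∷ʳ⁻ (z ∷ zs) (r ∷ l)   with Linked-∷ʳ⁻ zs l
    ... | l′ , r′ = r ∷ l′ , r′

    Linked-mapWith : ∀ {S : Rel A 0ℓ} {P : A → Set} {xs} → (∀ {x y} → P x → P y → R x y → S x y) →
                     All P xs → Linked R xs → Linked S xs
    Linked-mapWith f _                  []      = []
    Linked-mapWith f _                  [-]     = [-]
    Linked-mapWith f (px ∷ pxs@(py ∷ _)) (r ∷ l) = f px py r ∷ Linked-mapWith f pxs l

  module _ {P Q : Rel A 0ℓ} where

    splitAtFirst : ∀ {x xs} → Linked (λ u v → P u v ⊎ Q u v) (x ∷ xs) →
                   Linked Q (x ∷ xs) ⊎
                   ∃₂ λ ys z → ∃ λ zs → xs ≡ ys ++ z ∷ zs × Linked (λ u v → P u v ⊎ Q u v) (x ∷ ys) ×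
                                        P (lastOf x ys) z × Linked (λ u v → P u v ⊎ Q u v) (z ∷ zs)
    splitAtFirst [-]          = inj₁ [-]
    splitAtFirst (inj₁ p ∷ l) = inj₂ ([] , _ , _ , refl , [-] , p , l)
    splitAtFirst (inj₂ q ∷ l) with splitAtFirst l
    ... | inj₁ qs                                  = inj₁ (q ∷ qs)
    ... | inj₂ (ys , z , zs , refl , pre , p , post) = inj₂ (_ ∷ ys , z , zs , refl , inj₂ q ∷ pre , p , post)


Unique-map⁺-on : ∀ {A B : Set} {P : A → Set} (f : A → B) → (∀ {x y} → P x → P y → f x ≡ f y → x ≡ y) →
                 ∀ {xs} → All P xs → Unique xs → Unique (map f xs)
Unique-map⁺-on f inj []         []          = []
Unique-map⁺-on f inj (px ∷ pxs) (x∉ ∷ uniq) =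
  All.map⁺ (All.zipWith (λ (x≢y , py) fx≡fy → x≢y (inj px py fx≡fy)) (x∉ , pxs)) ∷ Unique-map⁺-on f inj pxs uniq

module FibredCycle {C X : Set} (F : C → List X) (_∼_ : Rel (C × X) 0ℓ)
                   (∼-sym : Symmetric _∼_) (∼-fibre : ∀ {c x y} → x ≢ y → (c , x) ∼ (c , y)) where

  fibre : C → List (C × X)
  fibre c = map (c ,_) (F c)

  total : List C → List (C × X)
  total []       = []
  total (c ∷ cs) = fibre c ++ total cs

  total-↭ : ∀ {cs ds} → cs ↭ ds → total cs ↭ total ds
  total-↭ _↭_.refl          = ↭-refl
  total-↭ (prep c p)        = ++⁺ˡ (fibre c) (total-↭ p)
  total-↭ (swap c d p)      = ↭-trans (shifts (fibre c) (fibre d)) (++⁺ˡ (fibre d) (++⁺ˡ (fibre c) (total-↭ p)))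
  total-↭ (_↭_.trans p q)   = ↭-trans (total-↭ p) (total-↭ q)

  ∈-total⁺ : ∀ {c cs x} → c ∈ cs → x ∈ F c → (c , x) ∈ total cs
  ∈-total⁺ {c} (here refl) x∈ = ∈-++⁺ˡ (∈-map⁺ (c ,_) x∈)
  ∈-total⁺ {cs = d ∷ _} (there c∈) x∈ = ∈-++⁺ʳ (fibre d) (∈-total⁺ c∈ x∈)

  ∈-total⁻ : ∀ cs {p} → p ∈ total cs → proj₁ p ∈ cs × proj₂ p ∈ F (proj₁ p)
  ∈-total⁻ (c ∷ cs) p∈ with ∈-++⁻ (fibre c) p∈
  ... | inj₂ p∈rest = let c∈ , x∈ = ∈-total⁻ cs p∈rest in there c∈ , x∈
  ... | inj₁ p∈fibre with ∈-map⁻ (c ,_) p∈fibre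
  ...   | _ , x∈ , refl = here refl , x∈

  total-unique : ∀ {cs} → Unique cs → All (Unique ∘ F) cs → Unique (total cs)
  total-unique []                   []          = []
  total-unique {c ∷ cs} (c∉ ∷ uniq) (uF ∷ uFs) =
    Unique.++⁺ (Unique.map⁺ (cong proj₂) uF) (total-unique uniq uFs) disjoint
    where
    disjoint : Disjoint (fibre c) (total cs)
    disjoint (p∈fibre , p∈rest) with ∈-map⁻ (c ,_) p∈fibre
    ... | _ , _ , refl = All.lookup c∉ (proj₁ (∈-total⁻ cs p∈rest)) refl

  Complete : C → C → Set
  Complete c d = ∀ x y → (c , x) ∼ (d , y)

  Parallel : C → C → Set
  Parallel c d = F c ≡ F d × ∀ x → (c , x) ∼ (d , x)

  Link : C → C → Set
  Link c d = Complete c d ⊎ Parallel c d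

  HamCycleOver : List C → Set
  HamCycleOver cs = ∃₂ λ p ps → Linked _∼_ (p ∷ ps ++ [ p ]) × p ∷ ps ↭ total cs

  HamCycleOver-↭ : ∀ {cs ds} → cs ↭ ds → HamCycleOver cs → HamCycleOver ds
  HamCycleOver-↭ cs↭ds (p , ps , cycle , perm) = p , ps , cycle , ↭-trans perm (total-↭ cs↭ds)

  walkFibre : ∀ c {a ys z zs} → Unique (a ∷ ys) → (c , lastOf a ys) ∼ z → Linked _∼_ (z ∷ zs) →
              Linked _∼_ ((c , a) ∷ map (c ,_) ys ++ z ∷ zs)
  walkFibre c {ys = []}     _               r l = r ∷ l
  walkFibre c {ys = _ ∷ _} ((a≢y ∷ _) ∷ u) r l = ∼-fibre a≢y ∷ walkFibre c u r l

  fibreFrom : ∀ {c a} → Unique (F c) → a ∈ F c →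
            ∃ λ ys → Unique (a ∷ ys) × lastOf a ys ∈ F c × (c , a) ∷ map (c ,_) ys ↭ fibre c
  fibreFrom {c} {a} uF a∈ with ∈⇒↭∷ a∈
  ... | ys , F↭a∷ys =
    ys , Unique-resp-↭ F↭a∷ys uF , ∈-resp-↭ (↭-sym F↭a∷ys) (lastOf-∈ a ys) , ↭-map⁺ (c ,_) (↭-sym F↭a∷ys)

  -- Across a parallel link the next fibre has to be entered at the point where the previous one was left.
  sweep : ∀ c cs {a} → Linked Link (c ∷ cs) → All (UniqueNonEmpty ∘ F) (c ∷ cs) → a ∈ F c →
          ∀ {q} → (∀ {b} → b ∈ F (lastOf c cs) → (lastOf c cs , b) ∼ q) →
          ∃ λ ps → Linked _∼_ ((c , a) ∷ ps ++ [ q ]) × (c , a) ∷ ps ↭ total (c ∷ cs)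
  sweep c [] [-] ((uF , _) ∷ []) a∈ toQ =
    let ys , row-unique , end∈ , row = fibreFrom uF a∈
    in map (c ,_) ys , walkFibre c row-unique (toQ end∈) [-] , ↭-trans row (↭-reflexive (sym (++-identityʳ (fibre c))))
  sweep c (d ∷ ds) {a} (link ∷ links) ((uF , _) ∷ fibres) a∈ {q} toQ =
    let ys , row-unique , end∈ , row = fibreFrom uF a∈
        a′ , a′∈ , hop = enter link end∈
        ps , walk , perm = sweep d ds links fibres a′∈ toQ
    in map (c ,_) ys ++ (d , a′) ∷ ps ,
       subst (λ t → Linked _∼_ ((c , a) ∷ t)) (sym (++-assoc (map (c ,_) ys) _ [ q ])) (walkFibre c row-unique hop walk) ,
       ++⁺ row perm
    where
    enter : ∀ {b} → Link c d → b ∈ F c → ∃ λ b′ → b′ ∈ F d × (c , b) ∼ (d , b′)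
    enter (inj₁ complete)           _  = let b′ , b′∈ = proj₂ (All.head fibres) in b′ , b′∈ , complete _ b′
    enter (inj₂ (Fc≡Fd , parallel)) b∈ = _ , subst (_ ∈_) Fc≡Fd b∈ , parallel _

  completeCycle : ∀ c cs → Linked Link (c ∷ cs) → Complete (lastOf c cs) c → All (UniqueNonEmpty ∘ F) (c ∷ cs) →
                  HamCycleOver (c ∷ cs)
  completeCycle c cs links complete fibres@((_ , a , a∈) ∷ _) =
    let ps , walk , perm = sweep c cs links fibres a∈ (λ {b} _ → complete b a) in (c , a) , ps , walk , perm

  fibreBetween : ∀ {c x y} → Unique (F c) → x ∈ F c → y ∈ F c → x ≢ y →
            ∃ λ zs → Unique (x ∷ zs) × lastOf x zs ∈ F c × lastOf x zs ≢ y ×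
                     (c , y) ∷ (c , x) ∷ map (c ,_) zs ↭ fibre c
  fibreBetween {c} {x} {y} uF x∈ y∈ x≢y with ∈²⇒↭∷∷ y∈ x∈ (≢-sym x≢y)
  ... | zs , F↭y∷x∷zs with Unique-resp-↭ F↭y∷x∷zs uF
  ...   | y∉ ∷ unique =
    zs , unique , ∈-resp-↭ (↭-sym F↭y∷x∷zs) (there (lastOf-∈ x zs)) , ≢-sym (All.lookup y∉ (lastOf-∈ x zs)) ,
    ↭-map⁺ (c ,_) (↭-sym F↭y∷x∷zs)

  -- The fibres are traversed forwards leaving out y, and the y-points are visited on the way back.
  parallelPath : ∀ c cs {x y} → Linked Parallel (c ∷ cs) → All (UniqueNonEmpty ∘ F) (c ∷ cs) → x ∈ F c → y ∈ F c → x ≢ y →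
                 ∃ λ ps → (∀ {qs} → Linked _∼_ ((c , y) ∷ qs) → Linked _∼_ ((c , x) ∷ ps ++ (c , y) ∷ qs)) ×
                          (c , y) ∷ (c , x) ∷ ps ↭ total (c ∷ cs)
  parallelPath c [] [-] ((uF , _) ∷ []) x∈ y∈ x≢y =
    let zs , row-unique , _ , end≢y , rows = fibreBetween uF x∈ y∈ x≢y
    in map (c ,_) zs , walkFibre c row-unique (∼-fibre end≢y) , ↭-trans rows (↭-reflexive (sym (++-identityʳ (fibre c))))
  parallelPath c (d ∷ ds) {x} {y} ((Fc≡Fd , parallel) ∷ links) ((uF , _) ∷ fibres) x∈ y∈ x≢y =
    let zs , row-unique , end∈ , end≢y , rows = fibreBetween uF x∈ y∈ x≢y
        o = lastOf x zs
        ps , path , perm = parallelPath d ds links fibres (subst (o ∈_) Fc≡Fd end∈) (subst (y ∈_) Fc≡Fd y∈) end≢y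
    in map (c ,_) zs ++ (d , o) ∷ ps ++ [ (d , y) ] ,
       (λ {qs} l → subst (λ t → Linked _∼_ ((c , x) ∷ t))
                     (sym (++-∷ʳ-assoc (map (c ,_) zs) (d , o) ps (d , y) ((c , y) ∷ qs)))
                     (walkFibre c row-unique (parallel o) (path (∼-sym (parallel y) ∷ l)))) ,
       ++⁺ rows (↭-trans (↭-sym (∷↭∷ʳ (d , y) ((d , o) ∷ ps))) perm)

  total-parallel-singleton : ∀ {c cs e} → Linked Parallel (c ∷ cs) → F c ≡ [ e ] → total (c ∷ cs) ≡ map (_, e) (c ∷ cs)
  total-parallel-singleton {c} [-]                   Fc≡[e] = cong (λ xs → map (c ,_) xs ++ []) Fc≡[e]
  total-parallel-singleton {c} ((Fc≡Fd , _) ∷ links) Fc≡[e] =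
    cong₂ (λ xs ys → map (c ,_) xs ++ ys) Fc≡[e] (total-parallel-singleton links (trans (sym Fc≡Fd) Fc≡[e]))

  parallelCycle : ∀ c cs → Linked Parallel (c ∷ cs) → Parallel (lastOf c cs) c → All (UniqueNonEmpty ∘ F) (c ∷ cs) →
                  HamCycleOver (c ∷ cs)
  parallelCycle c cs links closing fibres@((uF , _ , x∈) ∷ _) with singleton⊎distinct uF x∈
  ... | inj₂ (x , y , x∈ , y∈ , x≢y) =
    let ps , path , perm = parallelPath c cs links fibres x∈ y∈ x≢y
    in (c , y) , (c , x) ∷ ps , ∼-fibre (≢-sym x≢y) ∷ path [-] , perm
  ... | inj₁ (e , Fc≡[e]) =
    (c , e) , map (_, e) cs ,
    subst (Linked _∼_) (map-++ (_, e) (c ∷ cs) [ c ])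
      (Linked.map⁺ (Linked.map (λ par → proj₂ par e) (Linked-join links closing [-]))) ,
    ↭-reflexive (sym (total-parallel-singleton links Fc≡[e]))

  data Rotation (c : C) (cs : List C) : Set where
    allParallel    : Linked Parallel (c ∷ cs) → Parallel (lastOf c cs) c → Rotation c cs
    closesComplete : ∀ d ds → d ∷ ds ↭ c ∷ cs → Linked Link (d ∷ ds) → Complete (lastOf d ds) d → Rotation c cs

  rotation : ∀ c cs → Linked Link (c ∷ cs) → Link (lastOf c cs) c → Rotation c cs
  rotation c cs links closing with splitAtFirst {P = Complete} {Q = Parallel} links
  ... | inj₂ (ys , d , ds , refl , pre , complete , post) =
    closesComplete d (ds ++ c ∷ ys) (++-comm (d ∷ ds) (c ∷ ys))
      (Linked-join post (subst (λ e → Link e c) (lastOf-++ c ys d ds) closing) pre)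
      (subst (λ e → Complete e d) (sym (lastOf-++ d ds c ys)) complete)
  ... | inj₁ parallels with closing
  ...   | inj₁ complete = closesComplete c cs ↭-refl (Linked.map inj₂ parallels) complete
  ...   | inj₂ parallel = allParallel parallels parallel

  -- A complete link is rotated to the end of the cycle, where it can close any sweep; without one all
  -- fibres coincide and the snake of parallelPath closes up inside the first fibre.
  fibredCycle : ∀ c cs → Linked Link (c ∷ cs ++ [ c ]) → All (UniqueNonEmpty ∘ F) (c ∷ cs) → HamCycleOver (c ∷ cs)
  fibredCycle c cs links fibres with Linked-∷ʳ⁻ cs links
  ... | links′ , closing with rotation c cs links′ closing
  ...   | allParallel parallels parallel = parallelCycle c cs parallels parallel fibres
  ...   | closesComplete d ds d∷ds↭ links″ complete =
    HamCycleOver-↭ d∷ds↭ (completeCycle d ds links″ complete (All-resp-↭ (↭-sym d∷ds↭) fibres))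

∣p∪q∣≤∣p∣+∣q∣ : ∀ {m} (p q : Subset m) → ∣ p ∪ q ∣ ≤ ∣ p ∣ + ∣ q ∣
∣p∪q∣≤∣p∣+∣q∣ []            []            = z≤n
∣p∪q∣≤∣p∣+∣q∣ (inside ∷ p)  (y ∷ q)       = s≤s (≤-trans (∣p∪q∣≤∣p∣+∣q∣ p q) (+-monoʳ-≤ ∣ p ∣ (∣p∣≤∣x∷p∣ y q)))
∣p∪q∣≤∣p∣+∣q∣ (outside ∷ p) (inside ∷ q)  = ≤-trans (s≤s (∣p∪q∣≤∣p∣+∣q∣ p q)) (≤-reflexive (sym (+-suc ∣ p ∣ ∣ q ∣)))
∣p∪q∣≤∣p∣+∣q∣ (outside ∷ p) (outside ∷ q) = ∣p∪q∣≤∣p∣+∣q∣ p q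

image : ∀ {m n} → (Fin m → Fin n) → Subset m → Subset n
image f []            = ⊥
image f (inside ∷ p)  = ⁅ f zero ⁆ ∪ image (f ∘ suc) p
image f (outside ∷ p) = image (f ∘ suc) p

∣image∣≤ : ∀ {m n} (f : Fin m → Fin n) p → ∣ image f p ∣ ≤ ∣ p ∣
∣image∣≤ {n = n} f [] = ≤-reflexive (∣⊥∣≡0 n)
∣image∣≤ f (inside ∷ p)  =
  ≤-trans (∣p∪q∣≤∣p∣+∣q∣ ⁅ f zero ⁆ _) (+-mono-≤ (≤-reflexive (∣⁅x⁆∣≡1 (f zero))) (∣image∣≤ (f ∘ suc) p))
∣image∣≤ f (outside ∷ p) = ∣image∣≤ (f ∘ suc) p

∈-image⁺ : ∀ {m n} (f : Fin m → Fin n) {x p} → x ∈ₛ p → f x ∈ₛ image f p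
∈-image⁺ f {p = inside ∷ _}  here       = x∈p∪q⁺ (inj₁ (x∈⁅x⁆ (f zero)))
∈-image⁺ f {p = inside ∷ _}  (there x∈) = x∈p∪q⁺ (inj₂ (∈-image⁺ (f ∘ suc) x∈))
∈-image⁺ f {p = outside ∷ _} (there x∈) = ∈-image⁺ (f ∘ suc) x∈

∈-image⁻ : ∀ {m n} (f : Fin m → Fin n) p {y} → y ∈ₛ image f p → ∃ λ x → x ∈ₛ p × f x ≡ y
∈-image⁻ f []            y∈ = ⊥-elim (∉⊥ y∈)
∈-image⁻ f (inside ∷ p)  y∈ with x∈p∪q⁻ ⁅ f zero ⁆ _ y∈
... | inj₁ y∈⁅fz⁆ = zero , here , sym (x∈⁅y⁆⇒x≡y (f zero) y∈⁅fz⁆)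
... | inj₂ y∈img  = let x , x∈ , fx≡y = ∈-image⁻ (f ∘ suc) p y∈img in suc x , there x∈ , fx≡y
∈-image⁻ f (outside ∷ p) y∈ = let x , x∈ , fx≡y = ∈-image⁻ (f ∘ suc) p y∈ in suc x , there x∈ , fx≡y

members : ∀ {m} → Subset m → List (Fin m)
members []            = []
members (inside ∷ p)  = zero ∷ map suc (members p)
members (outside ∷ p) = map suc (members p)

length-members : ∀ {m} (p : Subset m) → length (members p) ≡ ∣ p ∣
length-members []            = refl
length-members (inside ∷ p)  = cong suc (trans (length-map suc (members p)) (length-members p))
length-members (outside ∷ p) = trans (length-map suc (members p)) (length-members p)

members-unique : ∀ {m} (p : Subset m) → Unique (members p)
members-unique []            = []
members-unique (inside ∷ p)  = All.tabulate zero∉ ∷ Unique.map⁺ Fin.suc-injective (members-unique p)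
  where
  zero∉ : ∀ {x} → x ∈ map suc (members p) → zero ≢ x
  zero∉ x∈ with ∈-map⁻ suc x∈
  ... | _ , _ , refl = λ ()
members-unique (outside ∷ p) = Unique.map⁺ Fin.suc-injective (members-unique p)

∈-members⁻ : ∀ {m} (p : Subset m) {x} → x ∈ members p → x ∈ₛ p
∈-members⁻ (inside ∷ p)  (here refl) = here
∈-members⁻ (inside ∷ p)  (there x∈)  with ∈-map⁻ suc x∈
... | _ , y∈ , refl = there (∈-members⁻ p y∈)
∈-members⁻ (outside ∷ p) x∈          with ∈-map⁻ suc x∈
... | _ , y∈ , refl = there (∈-members⁻ p y∈)

lookup-∉ : ∀ {m} {x : Fin m} {p : Subset m} → x ∉ₛ p → lookup p x ≡ outside
lookup-∉ {x = x} {p} x∉ with lookup p x in eq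
... | inside  = contradiction (lookup⇒[]= x p eq) x∉
... | outside = refl

allVecs : ∀ k m → List (Vec (Fin k) m)
allVecs k zero    = [] ∷ []
allVecs k (suc m) = cartesianProductWith _∷_ (allFin k) (allVecs k m)

∈-allVecs : ∀ {k m} (v : Vec (Fin k) m) → v ∈ allVecs k m
∈-allVecs []      = here refl
∈-allVecs (x ∷ v) = ∈-cartesianProductWith⁺ _∷_ (∈-allFin x) (∈-allVecs v)

allVecs-unique : ∀ k m → Unique (allVecs k m)
allVecs-unique k zero    = [] ∷ []
allVecs-unique k (suc m) = Unique.cartesianProductWith⁺ _∷_ ∷-injective (Unique.allFin⁺ k) (allVecs-unique k m)

Edge-sym : ∀ G {u v} → Edge G u v → Edge G v u
Edge-sym G {u} {v} e = trans (Graph.sym G v u) e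

module _ {G : Graph} where

  Reach-⊆ : ∀ {W W′ u v} → (∀ {x} → x ∈ₛ W → x ∈ₛ W′) → Reach G W u v → Reach G W′ u v
  Reach-⊆ W⊆W′ here          = here
  Reach-⊆ W⊆W′ (step e w∈ r) = step e (W⊆W′ w∈) (Reach-⊆ W⊆W′ r)

  Reach-trans : ∀ {W u w v} → Reach G W u w → Reach G W w v → Reach G W u v
  Reach-trans here          r′ = r′
  Reach-trans (step e w∈ r) r′ = step e w∈ (Reach-trans r r′)

  connected-∪ : ∀ {A B u s} → ConnectedIn G A → ConnectedIn G B → u ∈ₛ A → s ∈ₛ B → Edge G u s →
                ConnectedIn G (A ∪ B)
  connected-∪ {A} {B} {u} {s} connA connB u∈ s∈ e x y x∈ y∈ =
    Reach-trans (toU (x∈p∪q⁻ A B x∈)) (fromU (x∈p∪q⁻ A B y∈))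
    where
    inA : ∀ {z} → z ∈ₛ A → z ∈ₛ A ∪ B
    inA z∈ = x∈p∪q⁺ (inj₁ z∈)
    inB : ∀ {z} → z ∈ₛ B → z ∈ₛ A ∪ B
    inB z∈ = x∈p∪q⁺ (inj₂ z∈)
    toU : x ∈ₛ A ⊎ x ∈ₛ B → Reach G (A ∪ B) x u
    toU (inj₁ x∈A) = Reach-⊆ inA (connA x u x∈A u∈)
    toU (inj₂ x∈B) = Reach-trans (Reach-⊆ inB (connB x s x∈B s∈)) (step (Edge-sym G e) (inA u∈) here)
    fromU : y ∈ₛ A ⊎ y ∈ₛ B → Reach G (A ∪ B) u y
    fromU (inj₁ y∈A) = Reach-⊆ inA (connA u y u∈ y∈A)
    fromU (inj₂ y∈B) = step e (inB s∈) (Reach-⊆ inB (connB s y s∈ y∈B))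

module _ {G H : Graph} (f : Fin (n G) → Fin (n H)) (f-edge : ∀ {a b} → Edge G a b → Edge H (f a) (f b)) where

  Reach-image : ∀ {W a b} → Reach G W a b → Reach H (image f W) (f a) (f b)
  Reach-image here          = here
  Reach-image (step e w∈ r) = step (f-edge e) (∈-image⁺ f w∈) (Reach-image r)

  connected-image : ∀ {W} → ConnectedIn G W → ConnectedIn H (image f W)
  connected-image {W} conn u v u∈ v∈ with ∈-image⁻ f W u∈ | ∈-image⁻ f W v∈
  ... | a , a∈ , refl | b , b∈ , refl = Reach-image (conn a b a∈ b∈)

proper? : ∀ k G (c : Coloring k G) → Dec (Proper k G c)
proper? k G c = Fin.all? λ u → Fin.all? λ v → (adj G u v Bool.≟ true) →-dec ¬? (lookup c u Fin.≟ lookup c v)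

ReconfAdj-sym : ∀ {j k G c d} → ReconfAdj j k G c d → ReconfAdj j k G d c
ReconfAdj-sym (c≢d , W , ∣W∣≤j , differ⊆W , connW) = ≢-sym c≢d , W , ∣W∣≤j , (λ v → differ⊆W v ∘ ≢-sym) , connW

properColourings : ∀ k G → List (Coloring k G)
properColourings k G = filter (proper? k G) (allVecs k (n G))

complete⇒hamCycle⊎unique : ∀ {j k G} → ReconfComplete j k G → ChromaticAtMost k G →
                       ReconfHamCycle j k G ⊎ ∃ λ c → ∀ d → Proper k G d → d ≡ c
complete⇒hamCycle⊎unique {j} {k} {G} complete (c₀ , proper₀) =
  fromEnumeration (properColourings k G) (Unique.filter⁺ (proper? k G) (allVecs-unique k (n G)))
    (All.tabulate (proj₂ ∘ ∈-filter⁻ (proper? k G) {xs = allVecs k (n G)}))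
    (λ d proper → ∈-filter⁺ (proper? k G) (∈-allVecs d) proper)
  where
  fromEnumeration : ∀ cs → Unique cs → All (Proper k G) cs → (∀ d → Proper k G d → d ∈ cs) →
                    ReconfHamCycle j k G ⊎ ∃ λ c → ∀ d → Proper k G d → d ≡ c
  fromEnumeration []           _                  _      covers = contradiction (covers c₀ proper₀) λ ()
  fromEnumeration (c ∷ [])     _                  _      covers =
    inj₂ (c , λ d proper → case covers d proper of λ { (here d≡c) → d≡c })
  fromEnumeration (c ∷ d ∷ ds) uniq@(c∉ ∷ _) proper covers =
    inj₁ (c , d ∷ ds , proper , uniq , covers ,
          Linked-mapWith (complete _ _) (All.++⁺ proper (All.head proper ∷ []))
            (Linked-join (Linked.AllPairs⇒Linked uniq) (≢-sym (All.lookup c∉ (lastOf-∈ d ds))) [-]))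

module VertexDeletion (H : Graph) (S : Subset (n H)) (H′ : Graph) (ι : Fin (n H′) → Fin (n H))
                      (deletion : IsVertexDeletion H S H′ ι) where

  ι-injective : ∀ {a b} → ι a ≡ ι b → a ≡ b
  ι-injective = proj₁ deletion _ _

  preimage : ∀ v → v ∉ₛ S → Fin (n H′)
  preimage v v∉ = proj₁ (Equivalence.to (proj₂ (proj₂ deletion) v) v∉)

  ι-preimage : ∀ v v∉ → ι (preimage v v∉) ≡ v
  ι-preimage v v∉ = proj₂ (Equivalence.to (proj₂ (proj₂ deletion) v) v∉)

  ι∉S : ∀ a → ι a ∉ₛ S
  ι∉S a = Equivalence.from (proj₂ (proj₂ deletion) (ι a)) (a , refl)

  preimage-ι : ∀ {a} v∉ → preimage (ι a) v∉ ≡ a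
  preimage-ι v∉ = ι-injective (ι-preimage _ v∉)

  preimage-irrelevant : ∀ {v} v∉ v∉′ → preimage v v∉ ≡ preimage v v∉′
  preimage-irrelevant v∉ v∉′ = ι-injective (trans (ι-preimage _ v∉) (sym (ι-preimage _ v∉′)))

  Edge-ι : ∀ {a b} → Edge H′ a b → Edge H (ι a) (ι b)
  Edge-ι {a} {b} e = trans (sym (proj₁ (proj₂ deletion) a b)) e

  Edge-preimage : ∀ {u v} u∉ v∉ → Edge H u v → Edge H′ (preimage u u∉) (preimage v v∉)
  Edge-preimage u∉ v∉ e =
    trans (proj₁ (proj₂ deletion) _ _) (subst₂ (Edge H) (sym (ι-preimage _ u∉)) (sym (ι-preimage _ v∉)) e)

module Splice (k₀ : ℕ) (H : Graph) (S : Subset (n H)) (H′ : Graph) (ι : Fin (n H′) → Fin (n H))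
              (deletion : IsVertexDeletion H S H′ ι) where

  open VertexDeletion H S H′ ι deletion

  k : ℕ
  k = suc k₀

  pick : Coloring k H′ → Coloring k H → Fin (n H) → Fin k
  pick c σ v with v ∈? S
  ... | yes _  = lookup σ v
  ... | no v∉ = lookup c (preimage v v∉)

  merge : Coloring k H′ → Coloring k H → Coloring k H
  merge c σ = tabulate (pick c σ)

  lookup-merge-∈ : ∀ c σ {v} → v ∈ₛ S → lookup (merge c σ) v ≡ lookup σ v
  lookup-merge-∈ c σ {v} v∈ rewrite lookup∘tabulate (pick c σ) v with v ∈? S
  ... | yes _  = refl
  ... | no v∉ = contradiction v∈ v∉

  lookup-merge-∉ : ∀ c σ {v} (v∉ : v ∉ₛ S) → lookup (merge c σ) v ≡ lookup c (preimage v v∉)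
  lookup-merge-∉ c σ {v} v∉ rewrite lookup∘tabulate (pick c σ) v with v ∈? S
  ... | yes v∈  = contradiction v∈ v∉
  ... | no v∉′ = cong (lookup c) (preimage-irrelevant v∉′ v∉)

  lookup-merge-ι : ∀ c σ a → lookup (merge c σ) (ι a) ≡ lookup c a
  lookup-merge-ι c σ a = trans (lookup-merge-∉ c σ (ι∉S a)) (cong (lookup c) (preimage-ι (ι∉S a)))

  ≡-onSides : ∀ {d e : Coloring k H} → (∀ {v} → v ∈ₛ S → lookup d v ≡ lookup e v) →
              (∀ {v} → v ∉ₛ S → lookup d v ≡ lookup e v) → d ≡ e
  ≡-onSides on off = Pointwise-≡⇒≡ (ext λ v → case v ∈? S of λ { (yes v∈) → on v∈ ; (no v∉) → off v∉ })

  restrict : Coloring k H → Coloring k H′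
  restrict d = tabulate (lookup d ∘ ι)

  lookup-restrict-preimage : ∀ d {v} (v∉ : v ∉ₛ S) → lookup (restrict d) (preimage v v∉) ≡ lookup d v
  lookup-restrict-preimage d {v} v∉ =
    trans (lookup∘tabulate (lookup d ∘ ι) (preimage v v∉)) (cong (lookup d) (ι-preimage v v∉))

  restrict-merge : ∀ c σ → restrict (merge c σ) ≡ c
  restrict-merge c σ = Pointwise-≡⇒≡ (ext λ a → trans (lookup∘tabulate _ a) (lookup-merge-ι c σ a))

  merge-restrict : ∀ d → merge (restrict d) d ≡ d
  merge-restrict d = ≡-onSides (lookup-merge-∈ _ d) (λ v∉ → trans (lookup-merge-∉ _ d v∉) (lookup-restrict-preimage d v∉))

  merge-injectiveˡ : ∀ {c c′} σ σ′ → merge c σ ≡ merge c′ σ′ → c ≡ c′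
  merge-injectiveˡ {c} {c′} σ σ′ eq = trans (sym (restrict-merge c σ)) (trans (cong restrict eq) (restrict-merge c′ σ′))

  merge-≢ : ∀ {c c′} σ σ′ → c ≢ c′ → merge c σ ≢ merge c′ σ′
  merge-≢ σ σ′ c≢c′ = c≢c′ ∘ merge-injectiveˡ σ σ′

  Proper-restrict : ∀ d → Proper k H d → Proper k H′ (restrict d)
  Proper-restrict d proper a b e eq =
    proper _ _ (Edge-ι e) (trans (sym (lookup∘tabulate _ a)) (trans eq (lookup∘tabulate _ b)))

  merge-proper-off-S : ∀ {c} σ → Proper k H′ c → ∀ {u v} (u∉ : u ∉ₛ S) (v∉ : v ∉ₛ S) → Edge H u v →
                       lookup (merge c σ) u ≢ lookup (merge c σ) v
  merge-proper-off-S {c} σ proper u∉ v∉ e eq =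
    proper _ _ (Edge-preimage u∉ v∉ e) (trans (sym (lookup-merge-∉ c σ u∉)) (trans eq (lookup-merge-∉ c σ v∉)))

  -- A colouring of H[S] is represented by a colouring of H that is zero outside S.
  IsPattern : Coloring k H → Set
  IsPattern σ = ∀ v → v ∉ₛ S → lookup σ v ≡ zero

  toPattern : Coloring k H → Coloring k H
  toPattern = merge (replicate _ zero)

  toPattern-isPattern : ∀ σ → IsPattern (toPattern σ)
  toPattern-isPattern σ v v∉ = trans (lookup-merge-∉ _ σ v∉) (lookup-replicate (preimage v v∉) zero)

  merge-toPattern : ∀ c σ → merge c (toPattern σ) ≡ merge c σ
  merge-toPattern c σ = ≡-onSides
    (λ v∈ → trans (lookup-merge-∈ c _ v∈) (trans (lookup-merge-∈ _ σ v∈) (sym (lookup-merge-∈ c σ v∈))))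
    (λ v∉ → trans (lookup-merge-∉ c _ v∉) (sym (lookup-merge-∉ c σ v∉)))

  merge-restrict-toPattern : ∀ d → merge (restrict d) (toPattern d) ≡ d
  merge-restrict-toPattern d = trans (merge-toPattern _ d) (merge-restrict d)

  merge-injective : ∀ {c c′ σ σ′} → IsPattern σ → IsPattern σ′ → merge c σ ≡ merge c′ σ′ → c ≡ c′ × σ ≡ σ′
  merge-injective {c} {c′} {σ} {σ′} pσ pσ′ eq =
    merge-injectiveˡ σ σ′ eq ,
    ≡-onSides (λ v∈ → trans (sym (lookup-merge-∈ c σ v∈)) (trans (cong (λ d → lookup d _) eq) (lookup-merge-∈ c′ σ′ v∈)))
              (λ v∉ → trans (pσ _ v∉) (sym (pσ′ _ v∉)))

  isPattern? : ∀ σ → Dec (IsPattern σ)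
  isPattern? σ = Fin.all? λ v → ¬? (v ∈? S) →-dec (lookup σ v Fin.≟ zero)

  extensions : Coloring k H′ → List (Coloring k H)
  extensions c = filter (proper? k H ∘ merge c) (filter isPattern? (allVecs k (n H)))

  ∈-extensions⁺ : ∀ {c σ} → IsPattern σ → Proper k H (merge c σ) → σ ∈ extensions c
  ∈-extensions⁺ {c} {σ} pσ proper = ∈-filter⁺ (proper? k H ∘ merge c) (∈-filter⁺ isPattern? (∈-allVecs σ) pσ) proper

  ∈-extensions⁻ : ∀ {c σ} → σ ∈ extensions c → IsPattern σ × Proper k H (merge c σ)
  ∈-extensions⁻ {c} σ∈ with ∈-filter⁻ (proper? k H ∘ merge c) σ∈
  ... | σ∈patterns , proper = proj₂ (∈-filter⁻ isPattern? {xs = allVecs k (n H)} σ∈patterns) , proper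

  extensions-unique : ∀ c → Unique (extensions c)
  extensions-unique c = Unique.filter⁺ _ (Unique.filter⁺ _ (allVecs-unique k (n H)))

  Touches : Subset (n H′) → Set
  Touches W = ∃₂ λ a s → a ∈ₛ W × s ∈ₛ S × Edge H (ι a) s

  touches? : ∀ W → Dec (Touches W)
  touches? W = Fin.any? λ a → Fin.any? λ s → (a ∈? W) ×-dec (s ∈? S) ×-dec (adj H (ι a) s Bool.≟ true)

  agreeOnS : ∀ c c′ σ {v} → v ∈ₛ S → lookup (merge c σ) v ≡ lookup (merge c′ σ) v
  agreeOnS c c′ σ v∈ = trans (lookup-merge-∈ c σ v∈) (sym (lookup-merge-∈ c′ σ v∈))

  module _ {c c′ : Coloring k H′} {W} (differ⊆W : ∀ a → lookup c a ≢ lookup c′ a → a ∈ₛ W) (¬touches : ¬ Touches W) where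

    agreeNearS : ∀ σ {s v} → s ∈ₛ S → Edge H s v → lookup (merge c σ) v ≡ lookup (merge c′ σ) v
    agreeNearS σ {s} {v} s∈ e with v ∈? S
    ... | yes v∈ = agreeOnS c c′ σ v∈
    ... | no v∉ with lookup c (preimage v v∉) Fin.≟ lookup c′ (preimage v v∉)
    ...   | yes same  = trans (lookup-merge-∉ c σ v∉) (trans same (sym (lookup-merge-∉ c′ σ v∉)))
    ...   | no differ = contradiction
      (preimage v v∉ , s , differ⊆W _ differ , s∈ , subst (λ u → Edge H u s) (sym (ι-preimage v v∉)) (Edge-sym H e))
      ¬touches

    transfer : ∀ σ → Proper k H′ c′ → Proper k H (merge c σ) → Proper k H (merge c′ σ)
    transfer σ proper′ proper u v e with u ∈? S | v ∈? S
    ... | no u∉  | no v∉  = merge-proper-off-S σ proper′ u∉ v∉ e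
    ... | yes u∈ | _      = λ eq →
      proper u v e (trans (agreeOnS c c′ σ u∈) (trans eq (sym (agreeNearS σ u∈ e))))
    ... | no _   | yes v∈ = λ eq →
      proper u v e (trans (agreeNearS σ v∈ (Edge-sym H e)) (trans eq (sym (agreeOnS c c′ σ v∈))))

  extensions-≡ : ∀ {c c′ W} → (∀ a → lookup c a ≢ lookup c′ a → a ∈ₛ W) → ¬ Touches W →
                 Proper k H′ c → Proper k H′ c′ → extensions c ≡ extensions c′
  extensions-≡ {c} {c′} differ⊆W ¬touches proper proper′ =
    filter-≐ (proper? k H ∘ merge c) (proper? k H ∘ merge c′)
      ((λ {σ} → transfer differ⊆W ¬touches σ proper′) , (λ {σ} → transfer (λ a → differ⊆W a ∘ ≢-sym) ¬touches σ proper))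
      (filter isPattern? (allVecs k (n H)))

module Choice (k₀ : ℕ) (H : Graph) (S : Subset (n H)) (H′ : Graph) (ι : Fin (n H′) → Fin (n H))
              (deletion : IsVertexDeletion H S H′ ι)
              (choosable : ChoosableOn H S (λ v → suc k₀ ∸ dOut H S v)) where

  open VertexDeletion H S H′ ι deletion
  open Splice k₀ H S H′ ι deletion

  outNeighbours : Fin (n H) → Subset (n H)
  outNeighbours v = tabulate (λ u → adj H v u ∧ not (lookup S u))

  ∈-outNeighbours⁺ : ∀ {v u} → Edge H v u → u ∉ₛ S → u ∈ₛ outNeighbours v
  ∈-outNeighbours⁺ {v} {u} e u∉ =
    lookup⇒[]= u _ (trans (lookup∘tabulate _ u) (cong₂ _∧_ e (cong not (lookup-∉ u∉))))

  code : Fin k → ℕ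
  code i = suc (toℕ i)

  -- Only decode ∘ code matters; the values of decode outside the image of code are arbitrary.
  decode : ℕ → Fin k
  decode x = pred x mod k

  decode-code : ∀ i → decode (code i) ≡ i
  decode-code i = Fin.toℕ-injective (trans (Fin.toℕ-fromℕ< _) (m<n⇒m%n≡m (Fin.toℕ<n i)))

  module _ (c : Coloring k H′) (proper : Proper k H′ c) where

    open ≡-Reasoning

    -- Only the values of c⁺ outside S are ever used; the zeros on S are placeholders.
    c⁺ : Coloring k H
    c⁺ = merge c (replicate _ zero)

    forbidden : Fin (n H) → Subset k
    forbidden v = image (lookup c⁺) (outNeighbours v)

    allowed : Fin (n H) → List (Fin k)
    allowed v = members (∁ (forbidden v))

    lists : Fin (n H) → List ℕ
    lists v = map code (take (k ∸ dOut H S v) (allowed v))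

    enough : ∀ v → k ∸ dOut H S v ≤ length (allowed v)
    enough v = subst (k ∸ dOut H S v ≤_) (sym (trans (length-members (∁ (forbidden v))) (∣∁p∣≡n∸∣p∣ (forbidden v))))
                     (∸-monoʳ-≤ k (∣image∣≤ (lookup c⁺) (outNeighbours v)))

    lists-assignment : ListAssignment H S (λ v → k ∸ dOut H S v) lists
    lists-assignment v _ =
      trans (length-map code (take f (allowed v))) (trans (length-take f (allowed v)) (m≤n⇒m⊓n≡m (enough v))) ,
      Unique.map⁺ (Fin.toℕ-injective ∘ suc-injective) (Unique.take⁺ f (members-unique (∁ (forbidden v)))) ,
      All.map⁺ (All.universal (λ _ → s≤s z≤n) _)
      where
      f : ℕ
      f = k ∸ dOut H S v

    φ : Fin (n H) → ℕ
    φ = proj₁ (choosable lists lists-assignment)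

    φ∈lists : ∀ v → v ∈ₛ S → φ v ∈ lists v
    φ∈lists = proj₁ (proj₂ (choosable lists lists-assignment))

    φ-proper : ∀ u v → u ∈ₛ S → v ∈ₛ S → Edge H u v → φ u ≢ φ v
    φ-proper = proj₂ (proj₂ (choosable lists lists-assignment))

    σ : Coloring k H
    σ = toPattern (tabulate (decode ∘ φ))

    σ-on-S : ∀ {v} → v ∈ₛ S → φ v ≡ code (lookup σ v) × lookup σ v ∉ₛ forbidden v
    σ-on-S {v} v∈ with ∈-map⁻ code (φ∈lists v v∈)
    ... | i , i∈ , φv≡ =
      trans φv≡ (cong code (sym σv≡i)) ,
      subst (_∉ₛ forbidden v) (sym σv≡i)
        (x∈∁p⇒x∉p (∈-members⁻ (∁ (forbidden v)) (Sublist.lookup (take-⊆ (k ∸ dOut H S v) (allowed v)) i∈)))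
      where
      σv≡i : lookup σ v ≡ i
      σv≡i = begin
        lookup σ v                         ≡⟨ lookup-merge-∈ _ _ v∈ ⟩
        lookup (tabulate (decode ∘ φ)) v   ≡⟨ lookup∘tabulate (decode ∘ φ) v ⟩
        decode (φ v)                       ≡⟨ cong decode φv≡ ⟩
        decode (code i)                    ≡⟨ decode-code i ⟩
        i                                  ∎

    crossing : ∀ {u v} → Edge H u v → u ∈ₛ S → v ∉ₛ S → lookup (merge c σ) u ≢ lookup (merge c σ) v
    crossing {u} {v} e u∈ v∉ eq =
      proj₂ (σ-on-S u∈) (subst (_∈ₛ forbidden u) (sym σu≡) (∈-image⁺ _ (∈-outNeighbours⁺ e v∉)))
      where
      σu≡ : lookup σ u ≡ lookup c⁺ v
      σu≡ = begin
        lookup σ u                 ≡⟨ lookup-merge-∈ c σ u∈ ⟨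
        lookup (merge c σ) u       ≡⟨ eq ⟩
        lookup (merge c σ) v       ≡⟨ lookup-merge-∉ c σ v∉ ⟩
        lookup c (preimage v v∉)   ≡⟨ lookup-merge-∉ c _ v∉ ⟨
        lookup c⁺ v                ∎

    merge-proper : Proper k H (merge c σ)
    merge-proper u v e with u ∈? S | v ∈? S
    ... | yes u∈ | yes v∈ = λ eq → φ-proper u v u∈ v∈ e (begin
      φ u                           ≡⟨ proj₁ (σ-on-S u∈) ⟩
      code (lookup σ u)             ≡⟨ cong code (lookup-merge-∈ c σ u∈) ⟨
      code (lookup (merge c σ) u)   ≡⟨ cong code eq ⟩
      code (lookup (merge c σ) v)   ≡⟨ cong code (lookup-merge-∈ c σ v∈) ⟩
      code (lookup σ v)             ≡⟨ proj₁ (σ-on-S v∈) ⟨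
      φ v                           ∎)
    ... | yes u∈ | no v∉  = crossing e u∈ v∉
    ... | no u∉  | yes v∈ = crossing (Edge-sym H e) v∈ u∉ ∘ sym
    ... | no u∉  | no v∉  = merge-proper-off-S σ proper u∉ v∉ e

    extension : ∃ (_∈ extensions c)
    extension = σ , ∈-extensions⁺ (toPattern-isPattern _) merge-proper

module Lifting (k₀ j h′ : ℕ) (H : Graph) (S : Subset (n H)) (H′ : Graph) (ι : Fin (n H′) → Fin (n H))
               (deletion : IsVertexDeletion H S H′ ι) (connS : ConnectedIn H S) (∣S∣≤j : ∣ S ∣ ≤ j)
               (choosable : ChoosableOn H S (λ v → suc k₀ ∸ dOut H S v)) where

  open VertexDeletion H S H′ ι deletion
  open Splice k₀ H S H′ ι deletion
  open Choice k₀ H S H′ ι deletion choosable using (extension)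

  adjacentViaS : ∀ {d d′} → d ≢ d′ → (∀ {v} → v ∉ₛ S → lookup d v ≡ lookup d′ v) → ReconfAdj (h′ + j) k H d d′
  adjacentViaS {d} {d′} d≢d′ agreeOff = d≢d′ , S , ≤-trans ∣S∣≤j (m≤n+m j h′) , differ⊆S , connS
    where
    differ⊆S : ∀ v → lookup d v ≢ lookup d′ v → v ∈ₛ S
    differ⊆S v ne with v ∈? S
    ... | yes v∈ = v∈
    ... | no v∉  = contradiction (agreeOff v∉) ne

  Extends : Coloring k H′ × Coloring k H → Set
  Extends p = proj₂ p ∈ extensions (proj₁ p)

  merge′ : Coloring k H′ × Coloring k H → Coloring k H
  merge′ = uncurry merge

  merge′-injective : ∀ {p q} → Extends p → Extends q → merge′ p ≡ merge′ q → p ≡ q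
  merge′-injective ep eq same =
    let c≡c′ , σ≡σ′ = merge-injective (proj₁ (∈-extensions⁻ ep)) (proj₁ (∈-extensions⁻ eq)) same in cong₂ _,_ c≡c′ σ≡σ′

  -- Adjacency is only asserted for pairs that are genuine colourings of H, which lets fibre steps and
  -- complete links hold without side conditions.
  _∼_ : Rel (Coloring k H′ × Coloring k H) 0ℓ
  p ∼ q = Extends p → Extends q → ReconfAdj (h′ + j) k H (merge′ p) (merge′ q)

  ∼-sym : Symmetric _∼_
  ∼-sym p∼q ep eq = ReconfAdj-sym (p∼q eq ep)

  ∼-fibre : ∀ {c σ σ′} → σ ≢ σ′ → (c , σ) ∼ (c , σ′)
  ∼-fibre {c} {σ} {σ′} σ≢σ′ eσ eσ′ =
    adjacentViaS (σ≢σ′ ∘ proj₂ ∘ merge-injective (proj₁ (∈-extensions⁻ eσ)) (proj₁ (∈-extensions⁻ eσ′)))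
                 (λ v∉ → trans (lookup-merge-∉ c σ v∉) (sym (lookup-merge-∉ c σ′ v∉)))

  open FibredCycle extensions _∼_ ∼-sym ∼-fibre

  differences-off-S : ∀ {c c′ W} → (∀ a → lookup c a ≢ lookup c′ a → a ∈ₛ W) → ∀ σ σ′ {v} →
                      lookup (merge c σ) v ≢ lookup (merge c′ σ′) v → v ∉ₛ S → v ∈ₛ image ι W
  differences-off-S {c} {c′} {W} differ⊆W σ σ′ {v} ne v∉ =
    subst (_∈ₛ image ι W) (ι-preimage v v∉)
      (∈-image⁺ ι (differ⊆W _ λ eq → ne (trans (lookup-merge-∉ c σ v∉) (trans eq (sym (lookup-merge-∉ c′ σ′ v∉))))))

  module _ {c c′ : Coloring k H′} {W : Subset (n H′)} (c≢c′ : c ≢ c′) (∣W∣≤h′ : ∣ W ∣ ≤ h′)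
           (differ⊆W : ∀ a → lookup c a ≢ lookup c′ a → a ∈ₛ W) (connW : ConnectedIn H′ W) where

    completeLink : Touches W → Complete c c′
    completeLink (a , s , a∈ , s∈ , e) σ σ′ _ _ =
      merge-≢ σ σ′ c≢c′ , image ι W ∪ S ,
      ≤-trans (∣p∪q∣≤∣p∣+∣q∣ (image ι W) S) (+-mono-≤ (≤-trans (∣image∣≤ ι W) ∣W∣≤h′) ∣S∣≤j) ,
      (λ v ne → case v ∈? S of λ where
        (yes v∈) → x∈p∪q⁺ (inj₂ v∈)
        (no v∉)  → x∈p∪q⁺ (inj₁ (differences-off-S differ⊆W σ σ′ ne v∉))) ,
      connected-∪ (connected-image ι Edge-ι connW) connS (∈-image⁺ ι a∈) s∈ e

    parallelLink : ¬ Touches W → Proper k H′ c → Proper k H′ c′ → Parallel c c′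
    parallelLink ¬touches proper proper′ = extensions-≡ differ⊆W ¬touches proper proper′ , λ σ _ _ →
      merge-≢ σ σ c≢c′ , image ι W , ≤-trans (∣image∣≤ ι W) (≤-trans ∣W∣≤h′ (m≤m+n h′ j)) ,
      (λ v ne → case v ∈? S of λ where
        (yes v∈) → contradiction (agreeOnS c c′ σ v∈) ne
        (no v∉)  → differences-off-S differ⊆W σ σ ne v∉) ,
      connected-image ι Edge-ι connW

  link : ∀ {c c′} → Proper k H′ c → Proper k H′ c′ → ReconfAdj h′ k H′ c c′ → Link c c′
  link proper proper′ (c≢c′ , W , ∣W∣≤h′ , differ⊆W , connW) with touches? W
  ... | yes touches = inj₁ (completeLink c≢c′ ∣W∣≤h′ differ⊆W connW touches)
  ... | no ¬touches = inj₂ (parallelLink c≢c′ ∣W∣≤h′ differ⊆W connW ¬touches proper proper′)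

  liftCycle : ReconfHamCycle h′ k H′ → ReconfHamCycle (h′ + j) k H
  liftCycle (c , cs , proper , unique , covers , adjacent)
    with fibredCycle c cs (Linked-mapWith link (All.++⁺ proper (All.head proper ∷ [])) adjacent)
                          (All.map (λ {d} proper-d → extensions-unique d , extension d proper-d) proper)
  ... | p , ps , cycle , perm =
    merge′ p , map merge′ ps , All.map⁺ (All.map (proj₂ ∘ ∈-extensions⁻) extends) ,
    Unique-map⁺-on merge′ merge′-injective extends
      (Unique-resp-↭ (↭-sym perm) (total-unique unique (All.universal extensions-unique (c ∷ cs)))) ,
    covering ,
    subst (Linked (ReconfAdj (h′ + j) k H)) (map-++ merge′ (p ∷ ps) [ p ])
      (Linked.map⁺ (Linked-mapWith (λ ep eq p∼q → p∼q ep eq) (All.++⁺ extends (All.head extends ∷ [])) cycle))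
    where
    extends : All Extends (p ∷ ps)
    extends = All.tabulate (λ q∈ → proj₂ (∈-total⁻ (c ∷ cs) (∈-resp-↭ perm q∈)))
    covering : ∀ d → Proper k H d → d ∈ merge′ p ∷ map merge′ ps
    covering d proper-d =
      subst (_∈ merge′ p ∷ map merge′ ps) (merge-restrict-toPattern d)
        (∈-map⁺ merge′ (∈-resp-↭ (↭-sym perm)
          (∈-total⁺ (covers _ (Proper-restrict d proper-d))
                    (∈-extensions⁺ (toPattern-isPattern d)
                                   (subst (Proper k H) (sym (merge-restrict-toPattern d)) proper-d)))))

  liftUnique : ∀ {c} → (∀ d → Proper k H′ d → d ≡ c) → ReconfComplete (h′ + j) k H
  liftUnique unique d d′ proper proper′ d≢d′ = adjacentViaS d≢d′ λ {v} v∉ → begin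
    lookup d v                            ≡⟨ lookup-restrict-preimage d v∉ ⟨
    lookup (restrict d) (preimage v v∉)   ≡⟨ cong (λ e → lookup e (preimage v v∉)) sameRestriction ⟩
    lookup (restrict d′) (preimage v v∉)  ≡⟨ lookup-restrict-preimage d′ v∉ ⟩
    lookup d′ v                           ∎
    where
    open ≡-Reasoning
    sameRestriction : restrict d ≡ restrict d′
    sameRestriction = trans (unique _ (Proper-restrict d proper)) (sym (unique _ (Proper-restrict d′ proper′)))

  liftHamiltonian : ReconfHamiltonian h′ k H′ → ChromaticAtMost k H′ → ReconfHamiltonian (h′ + j) k H
  liftHamiltonian (inj₂ cycle)    _ = inj₂ (liftCycle cycle)
  liftHamiltonian (inj₁ complete) χ with complete⇒hamCycle⊎unique complete χ
  ... | inj₁ cycle        = inj₂ (liftCycle cycle)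
  ... | inj₂ (_ , unique) = inj₁ (liftUnique unique)

mainTheorem7 : (j k : ℕ) → 1 ≤ j → 1 ≤ k →
    (H : Graph) (S : Subset (n H)) →
    ConnectedIn H S → ∣ S ∣ ≤ j →
    (H' : Graph) (ι : Fin (n H') → Fin (n H)) → IsVertexDeletion H S H' ι →
    ChromaticAtMost k H' →
    ChoosableOn H S (λ v → k ∸ dOut H S v) →
    ∀ h' h → IsHk k H' h' → IsHk k H h → h ≤ h' + j
mainTheorem7 j (suc k₀) 1≤j _ H S connS ∣S∣≤j H′ ι deletion χ choosable h′ h (_ , hamiltonian′ , _) (_ , _ , minimal) =
  ≮⇒≥ λ h′+j<h → minimal (h′ + j) (≤-trans 1≤j (m≤n+m j h′)) h′+j<h (liftHamiltonian hamiltonian′ χ)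
  where open Lifting k₀ j h′ H S H′ ι deletion connS ∣S∣≤j choosable
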